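{- There exists a $CS(3,K_4^{(3)}+e,gn+2)$ of type $(g^n:2)$ for each $(g,n)\in\{(5,3),(5,5),(10,2)\}$.
   Context: $K_4^{(3)}+e$ denotes the 3-uniform hypergraph with vertex set $\{1,2,3,4,5\}$ and edge set $\{\{1,2,3\},\{1,2,4\},\{1,3,4\},\{2,3,4\},\{3,4,5\}\}$. A $CS(3,K_4^{(3)}+e,gn+s)$ of type $(g^n:s)$ is a quadruple $(X,S,\mathcal{T},\mathcal{A})$ where $X$ is a set of $gn+s$ points, $S\subseteq X$ with $|S|=s$ (the stem), $\mathcal{T}=\{G_1,\dots,G_n\}$ is a partition of $X\setminus S$ into $n$ groups of size $g$, and $\mathcal{A}$ is a collection of hypergraphs (blocks) on subsets of $X$, each isomorphic to $K_4^{(3)}+e$, such that every 3-subset $T\subseteq X$ with $|T\cap(S\cup G_i)|<3$ for all $i$ is an edge of exactly one block, and no 3-subset of any $S\cup G_i$ is an edge of any block. Here $s=2$. -}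

module Defs where

open import Data.Nat using (ℕ; zero; suc; _+_; _*_)
open import Data.Fin using (Fin; zero; suc; _≟_)
open import Data.Bool using (Bool; true; false; _∧_; _∨_; if_then_else_)
open import Data.Maybe using (Maybe; just; nothing)
open import Data.List using (List; []; _∷_; map)
open import Data.Nat.ListAction using (sum)
open import Data.Product using (Σ; _×_; _,_; proj₁)
open import Data.Sum using (_⊎_)
open import Relation.Nullary using (¬_)
open import Relation.Nullary.Decidable using (⌊_⌋)
open import Relation.Binary.PropositionalEquality using (_≡_; _≢_)
open import Function.Definitions using (Injective)

countFin : ∀ {v} → (Fin v → Bool) → ℕ
countFin {zero}  p = 0
countFin {suc v} p = (if p zero then 1 else 0) + countFin (λ x → p (suc x))

-- a triple of points (a 3-subset when the entries are pairwise distinct)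
Triple : ℕ → Set
Triple v = Fin v × Fin v × Fin v

Distinct3 : ∀ {v} → Triple v → Set
Distinct3 (a , b , c) = a ≢ b × a ≢ c × b ≢ c

-- The hypergraph K_4^(3)+e on vertex set Fin 5 = {1,...,5} (0-indexed):
-- edges {1,2,3},{1,2,4},{1,3,4},{2,3,4},{3,4,5}
K4e-edges : List (Triple 5)
K4e-edges =
    (zero , suc zero , suc (suc zero))
  ∷ (zero , suc zero , suc (suc (suc zero)))
  ∷ (zero , suc (suc zero) , suc (suc (suc zero)))
  ∷ (suc zero , suc (suc zero) , suc (suc (suc zero)))
  ∷ (suc (suc zero) , suc (suc (suc zero)) , suc (suc (suc (suc zero))))
  ∷ []

-- a block: a copy of K_4^(3)+e in the point set, given by an injective
-- placement of its 5 vertices; its edges are the images of K4e-edges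
Block : ℕ → Set
Block v = Σ (Fin 5 → Fin v) (λ f → Injective _≡_ _≡_ f)

mapTriple : ∀ {v} → (Fin 5 → Fin v) → Triple 5 → Triple v
mapTriple f (i , j , k) = (f i , f j , f k)

blockEdges : ∀ {v} → Block v → List (Triple v)
blockEdges (f , _) = map (mapTriple f) K4e-edges

_∈ᵇ_ : ∀ {v} → Fin v → Triple v → Bool
x ∈ᵇ (a , b , c) = ⌊ x ≟ a ⌋ ∨ ⌊ x ≟ b ⌋ ∨ ⌊ x ≟ c ⌋

sameSet : ∀ {v} → Triple v → Triple v → Bool
sameSet t@(a , b , c) u@(x , y , z) =
  (a ∈ᵇ u) ∧ (b ∈ᵇ u) ∧ (c ∈ᵇ u) ∧ (x ∈ᵇ t) ∧ (y ∈ᵇ t) ∧ (z ∈ᵇ t)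

edgeCount : ∀ {v} → Triple v → Block v → ℕ
edgeCount T B = sum (map (λ e → if sameSet T e then 1 else 0) (blockEdges B))

blockCount : ∀ {v} → Triple v → List (Block v) → ℕ
blockCount T 𝒜 = sum (map (edgeCount T) 𝒜)

-- Membership in S ∪ G_i, where the partition is encoded by
-- part : X → Maybe (Fin n)  (nothing = stem point, just i = point of G_i)
InSG : ∀ {v n} → (Fin v → Maybe (Fin n)) → Fin n → Fin v → Set
InSG part i x = (part x ≡ nothing) ⊎ (part x ≡ just i)

TripleInSG : ∀ {v n} → (Fin v → Maybe (Fin n)) → Fin n → Triple v → Set
TripleInSG part i (a , b , c) = InSG part i a × InSG part i b × InSG part i c

isStem : ∀ {n} → Maybe (Fin n) → Bool
isStem nothing  = true
isStem (just _) = false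

isGroup : ∀ {n} → Fin n → Maybe (Fin n) → Bool
isGroup i nothing  = false
isGroup i (just j) = ⌊ i ≟ j ⌋

record CS (g n s : ℕ) : Set where
  field
    part       : Fin (g * n + s) → Maybe (Fin n)
    stem-size  : countFin (λ x → isStem (part x)) ≡ s
    group-size : ∀ (i : Fin n) → countFin (λ x → isGroup i (part x)) ≡ g
    blocks     : List (Block (g * n + s))
    covered    : ∀ (T : Triple (g * n + s)) → Distinct3 T →
                 (∀ i → ¬ TripleInSG part i T) →
                 blockCount T blocks ≡ 1
    avoided    : ∀ (T : Triple (g * n + s)) → Distinct3 T →
                 ∀ i → TripleInSG part i T →
                 blockCount T blocks ≡ 0

module Submission where

-- The proof is by explicit construction, as in the paper: for each parameter pair we
-- exhibit the point partition and the list of blocks, and the defining conditions of a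
-- CS are checked by evaluation.

open import Defs
open import Data.Nat using (ℕ)
open import Data.Product using (_×_; _,_)
open import Data.Sum using (_⊎_)
open import Relation.Binary.PropositionalEquality using (_≡_)

open import Data.Nat using (_+_; _*_)
import Data.Nat as ℕ
open import Data.Nat.Properties using (*-comm)
open import Data.Nat.ListAction using (sum)
open import Data.Nat.ListAction.Properties using (sum-++)
open import Data.Bool using (Bool; true; false; T; if_then_else_)
open import Data.Bool.Properties using (T-∧)
open import Data.Fin using (Fin; #_; _≟_; splitAt; quotient; cast)
open import Data.Fin.Properties using (all?; any?)
open import Data.Maybe using (Maybe; just; nothing)
import Data.Maybe.Properties as Maybe
open import Data.List using (List; []; _∷_; map; _++_; concatMap; filterᵇ)
open import Data.List.Properties using (map-++)
open import Data.Vec using (_∷_; []; lookup)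
open import Data.Product using (proj₁; proj₂; ∃)
open import Data.Sum using (inj₁; inj₂; [_,_]′)
open import Data.Empty using (⊥-elim)
open import Function using (_∘_; const)
open import Function.Bundles using (Equivalence)
open import Function.Definitions using (Injective)
open import Relation.Nullary using (Dec; does; ¬_; ¬?; _×-dec_; _⊎-dec_; _→-dec_)
open import Relation.Nullary.Decidable using (True; toWitness; from-yes; map′; dec-true; dec-false)
open import Relation.Binary.PropositionalEquality using (refl; cong; module ≡-Reasoning)

injective? : ∀ {m v} (f : Fin m → Fin v) → Dec (Injective _≡_ _≡_ f)
injective? f = map′ (λ inj {x} {y} → inj x y) (λ inj x y → inj)
  (all? λ x → all? λ y → (f x ≟ f y) →-dec (x ≟ y))

-- The block whose vertices 1,…,5 of K_4^(3)+e are the points a,b,c,d,e: its edges are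
-- abc, abd, acd, bcd (a copy of K_4^(3)) and cde.
block : ∀ {v} (a b c d e : Fin v) →
        {True (injective? (lookup (a ∷ b ∷ c ∷ d ∷ e ∷ [])))} → Block v
block a b c d e {distinct} = lookup (a ∷ b ∷ c ∷ d ∷ e ∷ []) , toWitness distinct

occurrences : ∀ {v} → Triple v → List (Triple v) → ℕ
occurrences t es = sum (map (λ e → if sameSet t e then 1 else 0) es)

blockCount≡occurrences : ∀ {v} (t : Triple v) (Bs : List (Block v)) →
                         blockCount t Bs ≡ occurrences t (concatMap blockEdges Bs)
blockCount≡occurrences t [] = refl
blockCount≡occurrences t (B ∷ Bs) = begin
  edgeCount t B + blockCount t Bs
    ≡⟨ cong (edgeCount t B +_) (blockCount≡occurrences t Bs) ⟩
  sum (map f (blockEdges B)) + sum (map f (concatMap blockEdges Bs))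
    ≡⟨ sum-++ (map f (blockEdges B)) (map f (concatMap blockEdges Bs)) ⟨
  sum (map f (blockEdges B) ++ map f (concatMap blockEdges Bs))
    ≡⟨ cong sum (map-++ f (blockEdges B) (concatMap blockEdges Bs)) ⟨
  occurrences t (blockEdges B ++ concatMap blockEdges Bs) ∎
  where
  open ≡-Reasoning
  f = λ e → if sameSet t e then 1 else 0

sum-filter : ∀ {A : Set} (f : A → ℕ) (p : A → Bool) →
             (∀ x → p x ≡ false → f x ≡ 0) →
             ∀ xs → sum (map f (filterᵇ p xs)) ≡ sum (map f xs)
sum-filter f p vanish [] = refl
sum-filter f p vanish (x ∷ xs) with p x in px
... | true  = cong (f x +_) (sum-filter f p vanish xs)
... | false = begin
  sum (map f (filterᵇ p xs))  ≡⟨ sum-filter f p vanish xs ⟩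
  sum (map f xs)              ≡⟨ cong (_+ sum (map f xs)) (vanish x px) ⟨
  f x + sum (map f xs)        ∎
  where open ≡-Reasoning

indicator-vanishes : ∀ {b c : Bool} → (T b → T c) → c ≡ false → (if b then 1 else 0) ≡ 0
indicator-vanishes {false} _   _    = refl
indicator-vanishes {true}  b⇒c refl = ⊥-elim (b⇒c _)

-- Discarding triples that fail a test passed by every copy of t does not change the
-- number of occurrences of t.  This lets the verifier work with short edge lists.
occurrences-filter : ∀ {v} (t : Triple v) (p : Triple v → Bool) →
                     (∀ e → T (sameSet t e) → T (p e)) →
                     ∀ es → occurrences t (filterᵇ p es) ≡ occurrences t es
occurrences-filter t p keep =
  sum-filter _ p (λ e → indicator-vanishes {sameSet t e} (keep e))

module Verifier {v n : ℕ} (part : Fin v → Maybe (Fin n)) (blocks : List (Block v)) where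

  inSG? : ∀ i x → Dec (InSG part i x)
  inSG? i x = Maybe.≡-dec _≟_ (part x) nothing ⊎-dec Maybe.≡-dec _≟_ (part x) (just i)

  Inside : Triple v → Set
  Inside t = ∃ λ i → TripleInSG part i t

  inside? : ∀ t → Dec (Inside t)
  inside? (a , b , c) = any? λ i → inSG? i a ×-dec inSG? i b ×-dec inSG? i c

  multiplicity : Triple v → ℕ
  multiplicity t = if does (inside? t) then 0 else 1

  distinct? : ∀ (t : Triple v) → Dec (Distinct3 t)
  distinct? (a , b , c) = ¬? (a ≟ b) ×-dec ¬? (a ≟ c) ×-dec ¬? (b ≟ c)

  edges : List (Triple v)
  edges = concatMap blockEdges blocks

  through : Fin v → List (Triple v) → List (Triple v)
  through x = filterᵇ (x ∈ᵇ_)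

  Correct : Fin v → Fin v → List (Triple v) → Set
  Correct a b es = ∀ c → Distinct3 (a , b , c) →
                   occurrences (a , b , c) es ≡ multiplicity (a , b , c)

  correct? : ∀ a b es → Dec (Correct a b es)
  correct? a b es = all? λ c →
    distinct? (a , b , c) →-dec (occurrences (a , b , c) es ℕ.≟ multiplicity (a , b , c))

  Verified : Set
  Verified = ∀ a b → Correct a b (through b (through a edges))

  -- The list es of edges through a is passed as an argument so that it is computed
  -- once for all b.
  verifyFrom? : ∀ a es → Dec (∀ b → Correct a b (through b es))
  verifyFrom? a es = all? λ b → correct? a b (through b es)

  verify? : Dec Verified
  verify? = all? λ a → verifyFrom? a (through a edges)

  blockCount-multiplicity : Verified → ∀ t → Distinct3 t →
                            blockCount t blocks ≡ multiplicity t
  blockCount-multiplicity ok t@(a , b , c) distinct = begin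
    blockCount t blocks
      ≡⟨ blockCount≡occurrences t blocks ⟩
    occurrences t edges
      ≡⟨ occurrences-filter t (a ∈ᵇ_) a∈ edges ⟨
    occurrences t (through a edges)
      ≡⟨ occurrences-filter t (b ∈ᵇ_) b∈ (through a edges) ⟨
    occurrences t (through b (through a edges))
      ≡⟨ ok a b c distinct ⟩
    multiplicity t ∎
    where
    open ≡-Reasoning
    a∈ : ∀ e → T (sameSet t e) → T (a ∈ᵇ e)
    a∈ e = proj₁ ∘ Equivalence.to T-∧
    b∈ : ∀ e → T (sameSet t e) → T (b ∈ᵇ e)
    b∈ e = proj₁ ∘ Equivalence.to T-∧ ∘ proj₂ ∘ Equivalence.to (T-∧ {a ∈ᵇ e})

  covered : Verified → ∀ t → Distinct3 t → (∀ i → ¬ TripleInSG part i t) →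
            blockCount t blocks ≡ 1
  covered ok t distinct outside = begin
    blockCount t blocks  ≡⟨ blockCount-multiplicity ok t distinct ⟩
    multiplicity t       ≡⟨ cong (if_then 0 else 1) (dec-false (inside? t) not-inside) ⟩
    1                    ∎
    where
    open ≡-Reasoning
    not-inside : ¬ Inside t
    not-inside (i , h) = outside i h

  avoided : Verified → ∀ t → Distinct3 t → ∀ i → TripleInSG part i t →
            blockCount t blocks ≡ 0
  avoided ok t distinct i h = begin
    blockCount t blocks  ≡⟨ blockCount-multiplicity ok t distinct ⟩
    multiplicity t       ≡⟨ cong (if_then 0 else 1) (dec-true (inside? t) (i , h)) ⟩
    0                    ∎
    where open ≡-Reasoning

stemSize : ∀ {v n} → (Fin v → Maybe (Fin n)) → ℕ
stemSize part = countFin (isStem ∘ part)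

groupSize : ∀ {v n} → (Fin v → Maybe (Fin n)) → Fin n → ℕ
groupSize part i = countFin (isGroup i ∘ part)

certify : ∀ {g n s} (part : Fin (g * n + s) → Maybe (Fin n))
          (blocks : List (Block (g * n + s))) →
          stemSize part ≡ s → (∀ i → groupSize part i ≡ g) →
          Verifier.Verified part blocks → CS g n s
certify part blocks stem-size group-size ok = record
  { part       = part
  ; stem-size  = stem-size
  ; group-size = group-size
  ; blocks     = blocks
  ; covered    = covered ok
  ; avoided    = avoided ok
  }
  where open Verifier part blocks

groupSizes? : ∀ {v n} (part : Fin v → Maybe (Fin n)) g → Dec (∀ i → groupSize part i ≡ g)
groupSizes? part g = all? λ i → groupSize part i ℕ.≟ g

-- The standard partition of the points 0,…,gn+s−1: the group G_i consists of the
-- points ig,…,ig+g−1, and the last s points form the stem.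
standardPart : ∀ g n s → Fin (g * n + s) → Maybe (Fin n)
standardPart g n s x =
  [ just ∘ quotient g ∘ cast (*-comm g n) , const nothing ]′ (splitAt (g * n) x)

blocks-5-3 : List (Block 17)
blocks-5-3 =
    block (# 0) (# 2) (# 11) (# 13) (# 3) ∷ block (# 0) (# 5) (# 13) (# 15) (# 1) ∷
    block (# 0) (# 7) (# 10) (# 16) (# 1) ∷ block (# 0) (# 7) (# 12) (# 14) (# 2) ∷
    block (# 0) (# 8) (# 10) (# 15) (# 9) ∷ block (# 0) (# 10) (# 2) (# 5) (# 4) ∷
    block (# 0) (# 10) (# 4) (# 14) (# 5) ∷ block (# 0) (# 11) (# 6) (# 9) (# 3) ∷
    block (# 0) (# 11) (# 7) (# 15) (# 1) ∷ block (# 0) (# 12) (# 2) (# 6) (# 10) ∷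
    block (# 0) (# 12) (# 4) (# 11) (# 8) ∷ block (# 0) (# 12) (# 8) (# 16) (# 13) ∷
    block (# 0) (# 14) (# 6) (# 5) (# 4) ∷ block (# 1) (# 3) (# 12) (# 14) (# 4) ∷
    block (# 1) (# 6) (# 14) (# 15) (# 2) ∷ block (# 1) (# 8) (# 11) (# 16) (# 2) ∷
    block (# 1) (# 8) (# 13) (# 10) (# 3) ∷ block (# 1) (# 9) (# 11) (# 15) (# 5) ∷
    block (# 1) (# 10) (# 7) (# 6) (# 0) ∷ block (# 1) (# 11) (# 0) (# 10) (# 6) ∷
    block (# 1) (# 11) (# 3) (# 6) (# 0) ∷ block (# 1) (# 12) (# 7) (# 5) (# 4) ∷
    block (# 1) (# 12) (# 8) (# 15) (# 2) ∷ block (# 1) (# 13) (# 0) (# 12) (# 9) ∷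
    block (# 1) (# 13) (# 3) (# 7) (# 11) ∷ block (# 1) (# 13) (# 9) (# 16) (# 14) ∷
    block (# 2) (# 4) (# 13) (# 10) (# 0) ∷ block (# 2) (# 5) (# 12) (# 15) (# 6) ∷
    block (# 2) (# 7) (# 10) (# 15) (# 3) ∷ block (# 2) (# 9) (# 12) (# 16) (# 3) ∷
    block (# 2) (# 9) (# 14) (# 11) (# 4) ∷ block (# 2) (# 11) (# 8) (# 7) (# 1) ∷
    block (# 2) (# 12) (# 1) (# 11) (# 7) ∷ block (# 2) (# 12) (# 4) (# 7) (# 1) ∷
    block (# 2) (# 13) (# 8) (# 6) (# 0) ∷ block (# 2) (# 13) (# 9) (# 15) (# 3) ∷
    block (# 2) (# 14) (# 1) (# 13) (# 5) ∷ block (# 2) (# 14) (# 4) (# 8) (# 12) ∷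
    block (# 2) (# 14) (# 5) (# 16) (# 10) ∷ block (# 3) (# 0) (# 14) (# 11) (# 1) ∷
    block (# 3) (# 5) (# 10) (# 12) (# 0) ∷ block (# 3) (# 5) (# 13) (# 16) (# 4) ∷
    block (# 3) (# 6) (# 13) (# 15) (# 7) ∷ block (# 3) (# 8) (# 11) (# 15) (# 4) ∷
    block (# 3) (# 10) (# 0) (# 9) (# 13) ∷ block (# 3) (# 10) (# 2) (# 14) (# 6) ∷
    block (# 3) (# 10) (# 6) (# 16) (# 11) ∷ block (# 3) (# 12) (# 9) (# 8) (# 2) ∷
    block (# 3) (# 13) (# 0) (# 8) (# 2) ∷ block (# 3) (# 13) (# 2) (# 12) (# 8) ∷
    block (# 3) (# 14) (# 5) (# 15) (# 4) ∷ block (# 3) (# 14) (# 9) (# 7) (# 1) ∷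
    block (# 4) (# 1) (# 10) (# 12) (# 2) ∷ block (# 4) (# 6) (# 11) (# 13) (# 1) ∷
    block (# 4) (# 6) (# 14) (# 16) (# 0) ∷ block (# 4) (# 7) (# 14) (# 15) (# 8) ∷
    block (# 4) (# 9) (# 12) (# 15) (# 0) ∷ block (# 4) (# 10) (# 5) (# 8) (# 2) ∷
    block (# 4) (# 10) (# 6) (# 15) (# 0) ∷ block (# 4) (# 11) (# 1) (# 5) (# 14) ∷
    block (# 4) (# 11) (# 3) (# 10) (# 7) ∷ block (# 4) (# 11) (# 7) (# 16) (# 12) ∷
    block (# 4) (# 13) (# 5) (# 9) (# 3) ∷ block (# 4) (# 14) (# 1) (# 9) (# 3) ∷
    block (# 4) (# 14) (# 3) (# 13) (# 9) ∷ block (# 5) (# 7) (# 3) (# 0) (# 12) ∷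
    block (# 5) (# 9) (# 0) (# 1) (# 6) ∷ block (# 5) (# 11) (# 3) (# 2) (# 9) ∷
    block (# 5) (# 11) (# 7) (# 14) (# 2) ∷ block (# 5) (# 11) (# 9) (# 12) (# 1) ∷
    block (# 5) (# 13) (# 7) (# 10) (# 11) ∷ block (# 5) (# 16) (# 4) (# 12) (# 13) ∷
    block (# 6) (# 5) (# 1) (# 2) (# 7) ∷ block (# 6) (# 8) (# 4) (# 1) (# 13) ∷
    block (# 6) (# 12) (# 4) (# 3) (# 5) ∷ block (# 6) (# 12) (# 5) (# 13) (# 2) ∷
    block (# 6) (# 12) (# 8) (# 10) (# 3) ∷ block (# 6) (# 14) (# 8) (# 11) (# 12) ∷
    block (# 6) (# 16) (# 0) (# 13) (# 14) ∷ block (# 7) (# 6) (# 2) (# 3) (# 8) ∷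
    block (# 7) (# 9) (# 0) (# 2) (# 14) ∷ block (# 7) (# 10) (# 9) (# 12) (# 13) ∷
    block (# 7) (# 13) (# 0) (# 4) (# 6) ∷ block (# 7) (# 13) (# 6) (# 14) (# 3) ∷
    block (# 7) (# 13) (# 9) (# 11) (# 4) ∷ block (# 7) (# 16) (# 1) (# 14) (# 10) ∷
    block (# 8) (# 5) (# 1) (# 3) (# 10) ∷ block (# 8) (# 7) (# 3) (# 4) (# 9) ∷
    block (# 8) (# 11) (# 5) (# 13) (# 14) ∷ block (# 8) (# 14) (# 1) (# 0) (# 7) ∷
    block (# 8) (# 14) (# 5) (# 12) (# 0) ∷ block (# 8) (# 14) (# 7) (# 10) (# 4) ∷
    block (# 8) (# 16) (# 2) (# 10) (# 11) ∷ block (# 9) (# 6) (# 2) (# 4) (# 11) ∷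
    block (# 9) (# 8) (# 4) (# 0) (# 5) ∷ block (# 9) (# 10) (# 2) (# 1) (# 8) ∷
    block (# 9) (# 10) (# 6) (# 13) (# 1) ∷ block (# 9) (# 10) (# 8) (# 11) (# 0) ∷
    block (# 9) (# 12) (# 6) (# 14) (# 10) ∷ block (# 9) (# 16) (# 3) (# 11) (# 12) ∷
    block (# 10) (# 11) (# 5) (# 6) (# 3) ∷ block (# 10) (# 15) (# 1) (# 5) (# 16) ∷
    block (# 10) (# 16) (# 4) (# 9) (# 7) ∷ block (# 11) (# 12) (# 6) (# 7) (# 4) ∷
    block (# 11) (# 15) (# 2) (# 6) (# 16) ∷ block (# 11) (# 16) (# 0) (# 5) (# 8) ∷
    block (# 12) (# 13) (# 7) (# 8) (# 0) ∷ block (# 12) (# 15) (# 3) (# 7) (# 16) ∷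
    block (# 12) (# 16) (# 1) (# 6) (# 9) ∷ block (# 13) (# 14) (# 8) (# 9) (# 1) ∷
    block (# 13) (# 15) (# 4) (# 8) (# 16) ∷ block (# 13) (# 16) (# 2) (# 7) (# 5) ∷
    block (# 14) (# 10) (# 9) (# 5) (# 2) ∷ block (# 14) (# 15) (# 0) (# 9) (# 16) ∷
    block (# 14) (# 16) (# 3) (# 8) (# 6) ∷
    []

design-5-3 : CS 5 3 2
design-5-3 = certify part blocks-5-3 refl
  (from-yes (groupSizes? part 5)) (from-yes (Verifier.verify? part blocks-5-3))
  where part = standardPart 5 3 2

blocks-5-5 : List (Block 27)
blocks-5-5 =
    block (# 0) (# 1) (# 20) (# 24) (# 12) ∷ block (# 0) (# 2) (# 8) (# 24) (# 25) ∷
    block (# 0) (# 4) (# 9) (# 19) (# 18) ∷ block (# 0) (# 5) (# 2) (# 7) (# 20) ∷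
    block (# 0) (# 5) (# 17) (# 16) (# 14) ∷ block (# 0) (# 5) (# 20) (# 19) (# 14) ∷
    block (# 0) (# 6) (# 19) (# 25) (# 10) ∷ block (# 0) (# 8) (# 4) (# 21) (# 25) ∷
    block (# 0) (# 8) (# 13) (# 16) (# 3) ∷ block (# 0) (# 9) (# 24) (# 7) (# 21) ∷
    block (# 0) (# 11) (# 4) (# 14) (# 1) ∷ block (# 0) (# 11) (# 19) (# 21) (# 8) ∷
    block (# 0) (# 12) (# 2) (# 19) (# 9) ∷ block (# 0) (# 12) (# 3) (# 24) (# 22) ∷
    block (# 0) (# 16) (# 21) (# 26) (# 10) ∷ block (# 0) (# 18) (# 14) (# 24) (# 25) ∷
    block (# 0) (# 20) (# 4) (# 16) (# 11) ∷ block (# 0) (# 21) (# 7) (# 23) (# 14) ∷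
    block (# 0) (# 23) (# 8) (# 22) (# 16) ∷ block (# 0) (# 25) (# 7) (# 20) (# 9) ∷
    block (# 0) (# 26) (# 6) (# 23) (# 19) ∷ block (# 0) (# 26) (# 10) (# 22) (# 14) ∷
    block (# 1) (# 0) (# 5) (# 15) (# 19) ∷ block (# 1) (# 2) (# 21) (# 20) (# 13) ∷
    block (# 1) (# 3) (# 9) (# 20) (# 25) ∷ block (# 1) (# 5) (# 20) (# 8) (# 22) ∷
    block (# 1) (# 6) (# 3) (# 8) (# 21) ∷ block (# 1) (# 6) (# 18) (# 17) (# 10) ∷
    block (# 1) (# 6) (# 21) (# 15) (# 10) ∷ block (# 1) (# 7) (# 15) (# 25) (# 11) ∷
    block (# 1) (# 9) (# 0) (# 22) (# 25) ∷ block (# 1) (# 9) (# 14) (# 17) (# 4) ∷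
    block (# 1) (# 12) (# 0) (# 10) (# 2) ∷ block (# 1) (# 12) (# 15) (# 22) (# 9) ∷
    block (# 1) (# 13) (# 3) (# 15) (# 5) ∷ block (# 1) (# 13) (# 4) (# 20) (# 23) ∷
    block (# 1) (# 17) (# 22) (# 26) (# 11) ∷ block (# 1) (# 19) (# 10) (# 20) (# 25) ∷
    block (# 1) (# 21) (# 0) (# 17) (# 12) ∷ block (# 1) (# 22) (# 8) (# 24) (# 10) ∷
    block (# 1) (# 24) (# 9) (# 23) (# 17) ∷ block (# 1) (# 25) (# 8) (# 21) (# 5) ∷
    block (# 1) (# 26) (# 7) (# 24) (# 15) ∷ block (# 1) (# 26) (# 11) (# 23) (# 10) ∷
    block (# 2) (# 1) (# 6) (# 16) (# 15) ∷ block (# 2) (# 3) (# 22) (# 21) (# 14) ∷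
    block (# 2) (# 4) (# 5) (# 21) (# 25) ∷ block (# 2) (# 5) (# 1) (# 23) (# 25) ∷
    block (# 2) (# 5) (# 10) (# 18) (# 0) ∷ block (# 2) (# 6) (# 21) (# 9) (# 23) ∷
    block (# 2) (# 7) (# 4) (# 9) (# 22) ∷ block (# 2) (# 7) (# 19) (# 18) (# 11) ∷
    block (# 2) (# 7) (# 22) (# 16) (# 11) ∷ block (# 2) (# 8) (# 16) (# 25) (# 12) ∷
    block (# 2) (# 13) (# 1) (# 11) (# 3) ∷ block (# 2) (# 13) (# 16) (# 23) (# 5) ∷
    block (# 2) (# 14) (# 0) (# 21) (# 24) ∷ block (# 2) (# 14) (# 4) (# 16) (# 6) ∷
    block (# 2) (# 15) (# 11) (# 21) (# 25) ∷ block (# 2) (# 18) (# 23) (# 26) (# 12) ∷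
    block (# 2) (# 20) (# 5) (# 24) (# 18) ∷ block (# 2) (# 22) (# 1) (# 18) (# 13) ∷
    block (# 2) (# 23) (# 9) (# 20) (# 11) ∷ block (# 2) (# 25) (# 9) (# 22) (# 6) ∷
    block (# 2) (# 26) (# 8) (# 20) (# 16) ∷ block (# 2) (# 26) (# 12) (# 24) (# 11) ∷
    block (# 3) (# 0) (# 6) (# 22) (# 25) ∷ block (# 3) (# 2) (# 7) (# 17) (# 16) ∷
    block (# 3) (# 4) (# 23) (# 22) (# 10) ∷ block (# 3) (# 6) (# 2) (# 24) (# 25) ∷
    block (# 3) (# 6) (# 11) (# 19) (# 1) ∷ block (# 3) (# 7) (# 22) (# 5) (# 24) ∷
    block (# 3) (# 8) (# 0) (# 5) (# 23) ∷ block (# 3) (# 8) (# 15) (# 19) (# 12) ∷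
    block (# 3) (# 8) (# 23) (# 17) (# 12) ∷ block (# 3) (# 9) (# 17) (# 25) (# 13) ∷
    block (# 3) (# 10) (# 0) (# 17) (# 7) ∷ block (# 3) (# 10) (# 1) (# 22) (# 20) ∷
    block (# 3) (# 14) (# 2) (# 12) (# 4) ∷ block (# 3) (# 14) (# 17) (# 24) (# 6) ∷
    block (# 3) (# 16) (# 12) (# 22) (# 25) ∷ block (# 3) (# 19) (# 24) (# 26) (# 13) ∷
    block (# 3) (# 21) (# 6) (# 20) (# 19) ∷ block (# 3) (# 23) (# 2) (# 19) (# 14) ∷
    block (# 3) (# 24) (# 5) (# 21) (# 12) ∷ block (# 3) (# 25) (# 5) (# 23) (# 7) ∷
    block (# 3) (# 26) (# 9) (# 21) (# 17) ∷ block (# 3) (# 26) (# 13) (# 20) (# 12) ∷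
    block (# 4) (# 0) (# 24) (# 23) (# 11) ∷ block (# 4) (# 1) (# 7) (# 23) (# 25) ∷
    block (# 4) (# 3) (# 8) (# 18) (# 17) ∷ block (# 4) (# 5) (# 18) (# 25) (# 14) ∷
    block (# 4) (# 7) (# 3) (# 20) (# 25) ∷ block (# 4) (# 7) (# 12) (# 15) (# 2) ∷
    block (# 4) (# 8) (# 23) (# 6) (# 20) ∷ block (# 4) (# 9) (# 1) (# 6) (# 24) ∷
    block (# 4) (# 9) (# 16) (# 15) (# 13) ∷ block (# 4) (# 9) (# 24) (# 18) (# 13) ∷
    block (# 4) (# 10) (# 3) (# 13) (# 0) ∷ block (# 4) (# 10) (# 18) (# 20) (# 7) ∷
    block (# 4) (# 11) (# 1) (# 18) (# 8) ∷ block (# 4) (# 11) (# 2) (# 23) (# 21) ∷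
    block (# 4) (# 15) (# 20) (# 26) (# 14) ∷ block (# 4) (# 17) (# 13) (# 23) (# 25) ∷
    block (# 4) (# 20) (# 6) (# 22) (# 13) ∷ block (# 4) (# 22) (# 7) (# 21) (# 15) ∷
    block (# 4) (# 24) (# 3) (# 15) (# 10) ∷ block (# 4) (# 25) (# 6) (# 24) (# 8) ∷
    block (# 4) (# 26) (# 5) (# 22) (# 18) ∷ block (# 4) (# 26) (# 14) (# 21) (# 13) ∷
    block (# 5) (# 0) (# 9) (# 21) (# 16) ∷ block (# 5) (# 1) (# 12) (# 3) (# 19) ∷
    block (# 5) (# 3) (# 13) (# 2) (# 21) ∷ block (# 5) (# 6) (# 0) (# 4) (# 17) ∷
    block (# 5) (# 7) (# 13) (# 4) (# 25) ∷ block (# 5) (# 9) (# 14) (# 24) (# 23) ∷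
    block (# 5) (# 10) (# 0) (# 24) (# 19) ∷ block (# 5) (# 10) (# 7) (# 12) (# 0) ∷
    block (# 5) (# 10) (# 22) (# 21) (# 19) ∷ block (# 5) (# 11) (# 24) (# 25) (# 15) ∷
    block (# 5) (# 13) (# 9) (# 1) (# 25) ∷ block (# 5) (# 13) (# 18) (# 21) (# 8) ∷
    block (# 5) (# 14) (# 4) (# 12) (# 1) ∷ block (# 5) (# 16) (# 9) (# 19) (# 6) ∷
    block (# 5) (# 16) (# 24) (# 1) (# 13) ∷ block (# 5) (# 17) (# 7) (# 24) (# 14) ∷
    block (# 5) (# 17) (# 8) (# 4) (# 2) ∷ block (# 5) (# 21) (# 1) (# 26) (# 15) ∷
    block (# 5) (# 23) (# 19) (# 4) (# 25) ∷ block (# 5) (# 25) (# 12) (# 0) (# 14) ∷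
    block (# 5) (# 26) (# 11) (# 3) (# 24) ∷ block (# 5) (# 26) (# 15) (# 2) (# 19) ∷
    block (# 6) (# 1) (# 5) (# 22) (# 17) ∷ block (# 6) (# 2) (# 13) (# 4) (# 15) ∷
    block (# 6) (# 4) (# 14) (# 3) (# 22) ∷ block (# 6) (# 5) (# 10) (# 20) (# 24) ∷
    block (# 6) (# 7) (# 1) (# 0) (# 18) ∷ block (# 6) (# 8) (# 14) (# 0) (# 25) ∷
    block (# 6) (# 10) (# 0) (# 13) (# 2) ∷ block (# 6) (# 11) (# 1) (# 20) (# 15) ∷
    block (# 6) (# 11) (# 8) (# 13) (# 1) ∷ block (# 6) (# 11) (# 23) (# 22) (# 15) ∷
    block (# 6) (# 12) (# 20) (# 25) (# 16) ∷ block (# 6) (# 14) (# 5) (# 2) (# 25) ∷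
    block (# 6) (# 14) (# 19) (# 22) (# 9) ∷ block (# 6) (# 17) (# 5) (# 15) (# 7) ∷
    block (# 6) (# 17) (# 20) (# 2) (# 14) ∷ block (# 6) (# 18) (# 8) (# 20) (# 10) ∷
    block (# 6) (# 18) (# 9) (# 0) (# 3) ∷ block (# 6) (# 22) (# 2) (# 26) (# 16) ∷
    block (# 6) (# 24) (# 15) (# 0) (# 25) ∷ block (# 6) (# 25) (# 13) (# 1) (# 10) ∷
    block (# 6) (# 26) (# 12) (# 4) (# 20) ∷ block (# 6) (# 26) (# 16) (# 3) (# 15) ∷
    block (# 7) (# 0) (# 10) (# 4) (# 23) ∷ block (# 7) (# 2) (# 6) (# 23) (# 18) ∷
    block (# 7) (# 3) (# 14) (# 0) (# 16) ∷ block (# 7) (# 6) (# 11) (# 21) (# 20) ∷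
    block (# 7) (# 8) (# 2) (# 1) (# 19) ∷ block (# 7) (# 9) (# 10) (# 1) (# 25) ∷
    block (# 7) (# 10) (# 6) (# 3) (# 25) ∷ block (# 7) (# 10) (# 15) (# 23) (# 5) ∷
    block (# 7) (# 11) (# 1) (# 14) (# 3) ∷ block (# 7) (# 12) (# 2) (# 21) (# 16) ∷
    block (# 7) (# 12) (# 9) (# 14) (# 2) ∷ block (# 7) (# 12) (# 24) (# 23) (# 16) ∷
    block (# 7) (# 13) (# 21) (# 25) (# 17) ∷ block (# 7) (# 18) (# 6) (# 16) (# 8) ∷
    block (# 7) (# 18) (# 21) (# 3) (# 10) ∷ block (# 7) (# 19) (# 5) (# 1) (# 4) ∷
    block (# 7) (# 19) (# 9) (# 21) (# 11) ∷ block (# 7) (# 20) (# 16) (# 1) (# 25) ∷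
    block (# 7) (# 23) (# 3) (# 26) (# 17) ∷ block (# 7) (# 25) (# 14) (# 2) (# 11) ∷
    block (# 7) (# 26) (# 13) (# 0) (# 21) ∷ block (# 7) (# 26) (# 17) (# 4) (# 16) ∷
    block (# 8) (# 1) (# 11) (# 0) (# 24) ∷ block (# 8) (# 3) (# 7) (# 24) (# 19) ∷
    block (# 8) (# 4) (# 10) (# 1) (# 17) ∷ block (# 8) (# 5) (# 11) (# 2) (# 25) ∷
    block (# 8) (# 7) (# 12) (# 22) (# 21) ∷ block (# 8) (# 9) (# 3) (# 2) (# 15) ∷
    block (# 8) (# 11) (# 7) (# 4) (# 25) ∷ block (# 8) (# 11) (# 16) (# 24) (# 6) ∷
    block (# 8) (# 12) (# 2) (# 10) (# 4) ∷ block (# 8) (# 13) (# 3) (# 22) (# 17) ∷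
    block (# 8) (# 13) (# 5) (# 10) (# 3) ∷ block (# 8) (# 13) (# 20) (# 24) (# 17) ∷
    block (# 8) (# 14) (# 22) (# 25) (# 18) ∷ block (# 8) (# 15) (# 5) (# 22) (# 12) ∷
    block (# 8) (# 15) (# 6) (# 2) (# 0) ∷ block (# 8) (# 19) (# 7) (# 17) (# 9) ∷
    block (# 8) (# 19) (# 22) (# 4) (# 11) ∷ block (# 8) (# 21) (# 17) (# 2) (# 25) ∷
    block (# 8) (# 24) (# 4) (# 26) (# 18) ∷ block (# 8) (# 25) (# 10) (# 3) (# 12) ∷
    block (# 8) (# 26) (# 14) (# 1) (# 22) ∷ block (# 8) (# 26) (# 18) (# 0) (# 17) ∷
    block (# 9) (# 0) (# 11) (# 2) (# 18) ∷ block (# 9) (# 2) (# 12) (# 1) (# 20) ∷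
    block (# 9) (# 4) (# 8) (# 20) (# 15) ∷ block (# 9) (# 5) (# 4) (# 3) (# 16) ∷
    block (# 9) (# 6) (# 12) (# 3) (# 25) ∷ block (# 9) (# 8) (# 13) (# 23) (# 22) ∷
    block (# 9) (# 10) (# 23) (# 25) (# 19) ∷ block (# 9) (# 12) (# 8) (# 0) (# 25) ∷
    block (# 9) (# 12) (# 17) (# 20) (# 7) ∷ block (# 9) (# 13) (# 3) (# 11) (# 0) ∷
    block (# 9) (# 14) (# 4) (# 23) (# 18) ∷ block (# 9) (# 14) (# 6) (# 11) (# 4) ∷
    block (# 9) (# 14) (# 21) (# 20) (# 18) ∷ block (# 9) (# 15) (# 8) (# 18) (# 5) ∷
    block (# 9) (# 15) (# 23) (# 0) (# 12) ∷ block (# 9) (# 16) (# 6) (# 23) (# 13) ∷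
    block (# 9) (# 16) (# 7) (# 3) (# 1) ∷ block (# 9) (# 20) (# 0) (# 26) (# 19) ∷
    block (# 9) (# 22) (# 18) (# 3) (# 25) ∷ block (# 9) (# 25) (# 11) (# 4) (# 13) ∷
    block (# 9) (# 26) (# 10) (# 2) (# 23) ∷ block (# 9) (# 26) (# 19) (# 1) (# 18) ∷
    block (# 10) (# 1) (# 6) (# 26) (# 20) ∷ block (# 10) (# 3) (# 24) (# 9) (# 25) ∷
    block (# 10) (# 5) (# 14) (# 1) (# 21) ∷ block (# 10) (# 6) (# 17) (# 8) (# 24) ∷
    block (# 10) (# 8) (# 18) (# 7) (# 1) ∷ block (# 10) (# 11) (# 5) (# 9) (# 22) ∷
    block (# 10) (# 12) (# 18) (# 9) (# 25) ∷ block (# 10) (# 14) (# 19) (# 4) (# 3) ∷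
    block (# 10) (# 15) (# 2) (# 1) (# 24) ∷ block (# 10) (# 15) (# 5) (# 4) (# 24) ∷
    block (# 10) (# 15) (# 12) (# 17) (# 5) ∷ block (# 10) (# 16) (# 4) (# 25) (# 20) ∷
    block (# 10) (# 18) (# 14) (# 6) (# 25) ∷ block (# 10) (# 18) (# 23) (# 1) (# 13) ∷
    block (# 10) (# 19) (# 9) (# 17) (# 6) ∷ block (# 10) (# 21) (# 4) (# 6) (# 18) ∷
    block (# 10) (# 21) (# 14) (# 24) (# 11) ∷ block (# 10) (# 22) (# 12) (# 4) (# 19) ∷
    block (# 10) (# 22) (# 13) (# 9) (# 7) ∷ block (# 10) (# 25) (# 17) (# 5) (# 19) ∷
    block (# 10) (# 26) (# 16) (# 8) (# 4) ∷ block (# 10) (# 26) (# 20) (# 7) (# 24) ∷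
    block (# 11) (# 2) (# 7) (# 26) (# 21) ∷ block (# 11) (# 4) (# 20) (# 5) (# 25) ∷
    block (# 11) (# 6) (# 10) (# 2) (# 22) ∷ block (# 11) (# 7) (# 18) (# 9) (# 20) ∷
    block (# 11) (# 9) (# 19) (# 8) (# 2) ∷ block (# 11) (# 10) (# 15) (# 0) (# 4) ∷
    block (# 11) (# 12) (# 6) (# 5) (# 23) ∷ block (# 11) (# 13) (# 19) (# 5) (# 25) ∷
    block (# 11) (# 15) (# 5) (# 18) (# 7) ∷ block (# 11) (# 16) (# 3) (# 2) (# 20) ∷
    block (# 11) (# 16) (# 6) (# 0) (# 20) ∷ block (# 11) (# 16) (# 13) (# 18) (# 6) ∷
    block (# 11) (# 17) (# 0) (# 25) (# 21) ∷ block (# 11) (# 19) (# 10) (# 7) (# 25) ∷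
    block (# 11) (# 19) (# 24) (# 2) (# 14) ∷ block (# 11) (# 22) (# 0) (# 7) (# 19) ∷
    block (# 11) (# 22) (# 10) (# 20) (# 12) ∷ block (# 11) (# 23) (# 13) (# 0) (# 15) ∷
    block (# 11) (# 23) (# 14) (# 5) (# 8) ∷ block (# 11) (# 25) (# 18) (# 6) (# 15) ∷
    block (# 11) (# 26) (# 17) (# 9) (# 0) ∷ block (# 11) (# 26) (# 21) (# 8) (# 20) ∷
    block (# 12) (# 0) (# 21) (# 6) (# 25) ∷ block (# 12) (# 3) (# 8) (# 26) (# 22) ∷
    block (# 12) (# 5) (# 15) (# 9) (# 3) ∷ block (# 12) (# 7) (# 11) (# 3) (# 23) ∷
    block (# 12) (# 8) (# 19) (# 5) (# 21) ∷ block (# 12) (# 11) (# 16) (# 1) (# 0) ∷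
    block (# 12) (# 13) (# 7) (# 6) (# 24) ∷ block (# 12) (# 14) (# 15) (# 6) (# 25) ∷
    block (# 12) (# 15) (# 11) (# 8) (# 25) ∷ block (# 12) (# 15) (# 20) (# 3) (# 10) ∷
    block (# 12) (# 16) (# 6) (# 19) (# 8) ∷ block (# 12) (# 17) (# 4) (# 3) (# 21) ∷
    block (# 12) (# 17) (# 7) (# 1) (# 21) ∷ block (# 12) (# 17) (# 14) (# 19) (# 7) ∷
    block (# 12) (# 18) (# 1) (# 25) (# 22) ∷ block (# 12) (# 23) (# 1) (# 8) (# 15) ∷
    block (# 12) (# 23) (# 11) (# 21) (# 13) ∷ block (# 12) (# 24) (# 10) (# 6) (# 9) ∷
    block (# 12) (# 24) (# 14) (# 1) (# 16) ∷ block (# 12) (# 25) (# 19) (# 7) (# 16) ∷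
    block (# 12) (# 26) (# 18) (# 5) (# 1) ∷ block (# 12) (# 26) (# 22) (# 9) (# 21) ∷
    block (# 13) (# 1) (# 22) (# 7) (# 25) ∷ block (# 13) (# 4) (# 9) (# 26) (# 23) ∷
    block (# 13) (# 6) (# 16) (# 5) (# 4) ∷ block (# 13) (# 8) (# 12) (# 4) (# 24) ∷
    block (# 13) (# 9) (# 15) (# 6) (# 22) ∷ block (# 13) (# 10) (# 16) (# 7) (# 25) ∷
    block (# 13) (# 12) (# 17) (# 2) (# 1) ∷ block (# 13) (# 14) (# 8) (# 7) (# 20) ∷
    block (# 13) (# 16) (# 12) (# 9) (# 25) ∷ block (# 13) (# 16) (# 21) (# 4) (# 11) ∷
    block (# 13) (# 17) (# 7) (# 15) (# 9) ∷ block (# 13) (# 18) (# 0) (# 4) (# 22) ∷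
    block (# 13) (# 18) (# 8) (# 2) (# 22) ∷ block (# 13) (# 18) (# 10) (# 15) (# 8) ∷
    block (# 13) (# 19) (# 2) (# 25) (# 23) ∷ block (# 13) (# 20) (# 10) (# 2) (# 17) ∷
    block (# 13) (# 20) (# 11) (# 7) (# 5) ∷ block (# 13) (# 24) (# 2) (# 9) (# 16) ∷
    block (# 13) (# 24) (# 12) (# 22) (# 14) ∷ block (# 13) (# 25) (# 15) (# 8) (# 17) ∷
    block (# 13) (# 26) (# 19) (# 6) (# 2) ∷ block (# 13) (# 26) (# 23) (# 5) (# 22) ∷
    block (# 14) (# 0) (# 5) (# 26) (# 24) ∷ block (# 14) (# 2) (# 23) (# 8) (# 25) ∷
    block (# 14) (# 5) (# 16) (# 7) (# 23) ∷ block (# 14) (# 7) (# 17) (# 6) (# 0) ∷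
    block (# 14) (# 9) (# 13) (# 0) (# 20) ∷ block (# 14) (# 10) (# 9) (# 8) (# 21) ∷
    block (# 14) (# 11) (# 17) (# 8) (# 25) ∷ block (# 14) (# 13) (# 18) (# 3) (# 2) ∷
    block (# 14) (# 15) (# 3) (# 25) (# 24) ∷ block (# 14) (# 17) (# 13) (# 5) (# 25) ∷
    block (# 14) (# 17) (# 22) (# 0) (# 12) ∷ block (# 14) (# 18) (# 8) (# 16) (# 5) ∷
    block (# 14) (# 19) (# 1) (# 0) (# 23) ∷ block (# 14) (# 19) (# 9) (# 3) (# 23) ∷
    block (# 14) (# 19) (# 11) (# 16) (# 9) ∷ block (# 14) (# 20) (# 3) (# 5) (# 17) ∷
    block (# 14) (# 20) (# 13) (# 23) (# 10) ∷ block (# 14) (# 21) (# 11) (# 3) (# 18) ∷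
    block (# 14) (# 21) (# 12) (# 8) (# 6) ∷ block (# 14) (# 25) (# 16) (# 9) (# 18) ∷
    block (# 14) (# 26) (# 15) (# 7) (# 3) ∷ block (# 14) (# 26) (# 24) (# 6) (# 23) ∷
    block (# 15) (# 1) (# 9) (# 11) (# 23) ∷ block (# 15) (# 1) (# 19) (# 4) (# 16) ∷
    block (# 15) (# 2) (# 17) (# 9) (# 24) ∷ block (# 15) (# 2) (# 18) (# 14) (# 12) ∷
    block (# 15) (# 6) (# 11) (# 26) (# 0) ∷ block (# 15) (# 8) (# 4) (# 14) (# 25) ∷
    block (# 15) (# 10) (# 19) (# 6) (# 1) ∷ block (# 15) (# 11) (# 22) (# 13) (# 4) ∷
    block (# 15) (# 13) (# 23) (# 12) (# 6) ∷ block (# 15) (# 16) (# 10) (# 14) (# 2) ∷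
    block (# 15) (# 17) (# 23) (# 14) (# 25) ∷ block (# 15) (# 19) (# 24) (# 9) (# 8) ∷
    block (# 15) (# 20) (# 7) (# 6) (# 4) ∷ block (# 15) (# 20) (# 10) (# 9) (# 4) ∷
    block (# 15) (# 20) (# 17) (# 22) (# 10) ∷ block (# 15) (# 21) (# 9) (# 25) (# 0) ∷
    block (# 15) (# 23) (# 3) (# 6) (# 18) ∷ block (# 15) (# 23) (# 19) (# 11) (# 25) ∷
    block (# 15) (# 24) (# 14) (# 22) (# 11) ∷ block (# 15) (# 25) (# 22) (# 10) (# 24) ∷
    block (# 15) (# 26) (# 0) (# 12) (# 4) ∷ block (# 15) (# 26) (# 21) (# 13) (# 9) ∷
    block (# 16) (# 2) (# 5) (# 12) (# 24) ∷ block (# 16) (# 2) (# 15) (# 0) (# 17) ∷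
    block (# 16) (# 3) (# 18) (# 5) (# 20) ∷ block (# 16) (# 3) (# 19) (# 10) (# 13) ∷
    block (# 16) (# 7) (# 12) (# 26) (# 1) ∷ block (# 16) (# 9) (# 0) (# 10) (# 25) ∷
    block (# 16) (# 11) (# 15) (# 7) (# 2) ∷ block (# 16) (# 12) (# 23) (# 14) (# 0) ∷
    block (# 16) (# 14) (# 24) (# 13) (# 7) ∷ block (# 16) (# 15) (# 20) (# 5) (# 9) ∷
    block (# 16) (# 17) (# 11) (# 10) (# 3) ∷ block (# 16) (# 18) (# 24) (# 10) (# 25) ∷
    block (# 16) (# 20) (# 10) (# 23) (# 12) ∷ block (# 16) (# 21) (# 8) (# 7) (# 0) ∷
    block (# 16) (# 21) (# 11) (# 5) (# 0) ∷ block (# 16) (# 21) (# 18) (# 23) (# 11) ∷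
    block (# 16) (# 22) (# 5) (# 25) (# 1) ∷ block (# 16) (# 24) (# 4) (# 7) (# 19) ∷
    block (# 16) (# 24) (# 15) (# 12) (# 25) ∷ block (# 16) (# 25) (# 23) (# 11) (# 20) ∷
    block (# 16) (# 26) (# 1) (# 13) (# 0) ∷ block (# 16) (# 26) (# 22) (# 14) (# 5) ∷
    block (# 17) (# 3) (# 6) (# 13) (# 20) ∷ block (# 17) (# 3) (# 16) (# 1) (# 18) ∷
    block (# 17) (# 4) (# 15) (# 11) (# 14) ∷ block (# 17) (# 4) (# 19) (# 6) (# 21) ∷
    block (# 17) (# 5) (# 1) (# 11) (# 25) ∷ block (# 17) (# 8) (# 13) (# 26) (# 2) ∷
    block (# 17) (# 10) (# 20) (# 14) (# 8) ∷ block (# 17) (# 12) (# 16) (# 8) (# 3) ∷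
    block (# 17) (# 13) (# 24) (# 10) (# 1) ∷ block (# 17) (# 16) (# 21) (# 6) (# 5) ∷
    block (# 17) (# 18) (# 12) (# 11) (# 4) ∷ block (# 17) (# 19) (# 20) (# 11) (# 25) ∷
    block (# 17) (# 20) (# 0) (# 8) (# 15) ∷ block (# 17) (# 20) (# 16) (# 13) (# 25) ∷
    block (# 17) (# 21) (# 11) (# 24) (# 13) ∷ block (# 17) (# 22) (# 9) (# 8) (# 1) ∷
    block (# 17) (# 22) (# 12) (# 6) (# 1) ∷ block (# 17) (# 22) (# 19) (# 24) (# 12) ∷
    block (# 17) (# 23) (# 6) (# 25) (# 2) ∷ block (# 17) (# 25) (# 24) (# 12) (# 21) ∷
    block (# 17) (# 26) (# 2) (# 14) (# 1) ∷ block (# 17) (# 26) (# 23) (# 10) (# 6) ∷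
    block (# 18) (# 0) (# 15) (# 7) (# 22) ∷ block (# 18) (# 0) (# 16) (# 12) (# 10) ∷
    block (# 18) (# 4) (# 7) (# 14) (# 21) ∷ block (# 18) (# 4) (# 17) (# 2) (# 19) ∷
    block (# 18) (# 6) (# 2) (# 12) (# 25) ∷ block (# 18) (# 9) (# 14) (# 26) (# 3) ∷
    block (# 18) (# 11) (# 21) (# 10) (# 9) ∷ block (# 18) (# 13) (# 17) (# 9) (# 4) ∷
    block (# 18) (# 14) (# 20) (# 11) (# 2) ∷ block (# 18) (# 15) (# 21) (# 12) (# 25) ∷
    block (# 18) (# 17) (# 22) (# 7) (# 6) ∷ block (# 18) (# 19) (# 13) (# 12) (# 0) ∷
    block (# 18) (# 21) (# 1) (# 9) (# 16) ∷ block (# 18) (# 21) (# 17) (# 14) (# 25) ∷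
    block (# 18) (# 22) (# 12) (# 20) (# 14) ∷ block (# 18) (# 23) (# 5) (# 9) (# 2) ∷
    block (# 18) (# 23) (# 13) (# 7) (# 2) ∷ block (# 18) (# 23) (# 15) (# 20) (# 13) ∷
    block (# 18) (# 24) (# 7) (# 25) (# 3) ∷ block (# 18) (# 25) (# 20) (# 13) (# 22) ∷
    block (# 18) (# 26) (# 3) (# 10) (# 2) ∷ block (# 18) (# 26) (# 24) (# 11) (# 7) ∷
    block (# 19) (# 0) (# 8) (# 10) (# 22) ∷ block (# 19) (# 0) (# 18) (# 3) (# 15) ∷
    block (# 19) (# 1) (# 16) (# 8) (# 23) ∷ block (# 19) (# 1) (# 17) (# 13) (# 11) ∷
    block (# 19) (# 5) (# 10) (# 26) (# 4) ∷ block (# 19) (# 7) (# 3) (# 13) (# 25) ∷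
    block (# 19) (# 10) (# 21) (# 12) (# 3) ∷ block (# 19) (# 12) (# 22) (# 11) (# 5) ∷
    block (# 19) (# 14) (# 18) (# 5) (# 0) ∷ block (# 19) (# 15) (# 14) (# 13) (# 1) ∷
    block (# 19) (# 16) (# 22) (# 13) (# 25) ∷ block (# 19) (# 18) (# 23) (# 8) (# 7) ∷
    block (# 19) (# 20) (# 8) (# 25) (# 4) ∷ block (# 19) (# 22) (# 2) (# 5) (# 17) ∷
    block (# 19) (# 22) (# 18) (# 10) (# 25) ∷ block (# 19) (# 23) (# 13) (# 21) (# 10) ∷
    block (# 19) (# 24) (# 6) (# 5) (# 3) ∷ block (# 19) (# 24) (# 14) (# 8) (# 3) ∷
    block (# 19) (# 24) (# 16) (# 21) (# 14) ∷ block (# 19) (# 25) (# 21) (# 14) (# 23) ∷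
    block (# 19) (# 26) (# 4) (# 11) (# 3) ∷ block (# 19) (# 26) (# 20) (# 12) (# 8) ∷
    block (# 20) (# 0) (# 12) (# 11) (# 9) ∷ block (# 20) (# 0) (# 15) (# 14) (# 9) ∷
    block (# 20) (# 0) (# 22) (# 2) (# 15) ∷ block (# 20) (# 1) (# 14) (# 25) (# 5) ∷
    block (# 20) (# 3) (# 8) (# 11) (# 23) ∷ block (# 20) (# 3) (# 24) (# 16) (# 25) ∷
    block (# 20) (# 4) (# 19) (# 2) (# 16) ∷ block (# 20) (# 6) (# 14) (# 16) (# 3) ∷
    block (# 20) (# 6) (# 24) (# 9) (# 21) ∷ block (# 20) (# 7) (# 22) (# 14) (# 4) ∷
    block (# 20) (# 7) (# 23) (# 19) (# 17) ∷ block (# 20) (# 11) (# 16) (# 26) (# 5) ∷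
    block (# 20) (# 13) (# 9) (# 19) (# 25) ∷ block (# 20) (# 15) (# 24) (# 11) (# 6) ∷
    block (# 20) (# 16) (# 2) (# 18) (# 9) ∷ block (# 20) (# 18) (# 3) (# 17) (# 11) ∷
    block (# 20) (# 21) (# 15) (# 19) (# 7) ∷ block (# 20) (# 22) (# 3) (# 19) (# 25) ∷
    block (# 20) (# 24) (# 4) (# 14) (# 13) ∷ block (# 20) (# 25) (# 2) (# 15) (# 4) ∷
    block (# 20) (# 26) (# 1) (# 18) (# 14) ∷ block (# 20) (# 26) (# 5) (# 17) (# 9) ∷
    block (# 21) (# 0) (# 15) (# 3) (# 17) ∷ block (# 21) (# 1) (# 13) (# 12) (# 5) ∷
    block (# 21) (# 1) (# 16) (# 10) (# 5) ∷ block (# 21) (# 1) (# 23) (# 3) (# 16) ∷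
    block (# 21) (# 2) (# 10) (# 25) (# 6) ∷ block (# 21) (# 4) (# 9) (# 12) (# 24) ∷
    block (# 21) (# 4) (# 20) (# 17) (# 25) ∷ block (# 21) (# 7) (# 10) (# 17) (# 4) ∷
    block (# 21) (# 7) (# 20) (# 5) (# 22) ∷ block (# 21) (# 8) (# 23) (# 10) (# 0) ∷
    block (# 21) (# 8) (# 24) (# 15) (# 18) ∷ block (# 21) (# 12) (# 17) (# 26) (# 6) ∷
    block (# 21) (# 14) (# 5) (# 15) (# 25) ∷ block (# 21) (# 16) (# 20) (# 12) (# 7) ∷
    block (# 21) (# 17) (# 3) (# 19) (# 5) ∷ block (# 21) (# 19) (# 4) (# 18) (# 12) ∷
    block (# 21) (# 20) (# 0) (# 10) (# 14) ∷ block (# 21) (# 22) (# 16) (# 15) (# 8) ∷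
    block (# 21) (# 23) (# 4) (# 15) (# 25) ∷ block (# 21) (# 25) (# 3) (# 16) (# 0) ∷
    block (# 21) (# 26) (# 2) (# 19) (# 10) ∷ block (# 21) (# 26) (# 6) (# 18) (# 5) ∷
    block (# 22) (# 0) (# 5) (# 13) (# 20) ∷ block (# 22) (# 0) (# 21) (# 18) (# 25) ∷
    block (# 22) (# 1) (# 16) (# 4) (# 18) ∷ block (# 22) (# 2) (# 14) (# 13) (# 6) ∷
    block (# 22) (# 2) (# 17) (# 11) (# 6) ∷ block (# 22) (# 2) (# 24) (# 4) (# 17) ∷
    block (# 22) (# 3) (# 11) (# 25) (# 7) ∷ block (# 22) (# 8) (# 11) (# 18) (# 0) ∷
    block (# 22) (# 8) (# 21) (# 6) (# 23) ∷ block (# 22) (# 9) (# 20) (# 16) (# 19) ∷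
    block (# 22) (# 9) (# 24) (# 11) (# 1) ∷ block (# 22) (# 10) (# 6) (# 16) (# 25) ∷
    block (# 22) (# 13) (# 18) (# 26) (# 7) ∷ block (# 22) (# 15) (# 0) (# 19) (# 13) ∷
    block (# 22) (# 17) (# 21) (# 13) (# 8) ∷ block (# 22) (# 18) (# 4) (# 15) (# 6) ∷
    block (# 22) (# 21) (# 1) (# 11) (# 10) ∷ block (# 22) (# 23) (# 17) (# 16) (# 9) ∷
    block (# 22) (# 24) (# 0) (# 16) (# 25) ∷ block (# 22) (# 25) (# 4) (# 17) (# 1) ∷
    block (# 22) (# 26) (# 3) (# 15) (# 11) ∷ block (# 22) (# 26) (# 7) (# 19) (# 6) ∷
    block (# 23) (# 1) (# 6) (# 14) (# 21) ∷ block (# 23) (# 1) (# 22) (# 19) (# 25) ∷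
    block (# 23) (# 2) (# 17) (# 0) (# 19) ∷ block (# 23) (# 3) (# 10) (# 14) (# 7) ∷
    block (# 23) (# 3) (# 18) (# 12) (# 7) ∷ block (# 23) (# 3) (# 20) (# 0) (# 18) ∷
    block (# 23) (# 4) (# 12) (# 25) (# 8) ∷ block (# 23) (# 5) (# 20) (# 12) (# 2) ∷
    block (# 23) (# 5) (# 21) (# 17) (# 15) ∷ block (# 23) (# 9) (# 12) (# 19) (# 1) ∷
    block (# 23) (# 9) (# 22) (# 7) (# 24) ∷ block (# 23) (# 11) (# 7) (# 17) (# 25) ∷
    block (# 23) (# 14) (# 19) (# 26) (# 8) ∷ block (# 23) (# 16) (# 1) (# 15) (# 14) ∷
    block (# 23) (# 18) (# 22) (# 14) (# 9) ∷ block (# 23) (# 19) (# 0) (# 16) (# 7) ∷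
    block (# 23) (# 20) (# 1) (# 17) (# 25) ∷ block (# 23) (# 22) (# 2) (# 12) (# 11) ∷
    block (# 23) (# 24) (# 18) (# 17) (# 5) ∷ block (# 23) (# 25) (# 0) (# 18) (# 2) ∷
    block (# 23) (# 26) (# 4) (# 16) (# 12) ∷ block (# 23) (# 26) (# 8) (# 15) (# 7) ∷
    block (# 24) (# 0) (# 13) (# 25) (# 9) ∷ block (# 24) (# 2) (# 7) (# 10) (# 22) ∷
    block (# 24) (# 2) (# 23) (# 15) (# 25) ∷ block (# 24) (# 3) (# 18) (# 1) (# 15) ∷
    block (# 24) (# 4) (# 11) (# 10) (# 8) ∷ block (# 24) (# 4) (# 19) (# 13) (# 8) ∷
    block (# 24) (# 4) (# 21) (# 1) (# 19) ∷ block (# 24) (# 5) (# 13) (# 15) (# 2) ∷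
    block (# 24) (# 5) (# 23) (# 8) (# 20) ∷ block (# 24) (# 6) (# 21) (# 13) (# 3) ∷
    block (# 24) (# 6) (# 22) (# 18) (# 16) ∷ block (# 24) (# 10) (# 15) (# 26) (# 9) ∷
    block (# 24) (# 12) (# 8) (# 18) (# 25) ∷ block (# 24) (# 15) (# 1) (# 17) (# 8) ∷
    block (# 24) (# 17) (# 2) (# 16) (# 10) ∷ block (# 24) (# 19) (# 23) (# 10) (# 5) ∷
    block (# 24) (# 20) (# 19) (# 18) (# 6) ∷ block (# 24) (# 21) (# 2) (# 18) (# 25) ∷
    block (# 24) (# 23) (# 3) (# 13) (# 12) ∷ block (# 24) (# 25) (# 1) (# 19) (# 3) ∷
    block (# 24) (# 26) (# 0) (# 17) (# 13) ∷ block (# 24) (# 26) (# 9) (# 16) (# 8) ∷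
    []

design-5-5 : CS 5 5 2
design-5-5 = certify part blocks-5-5 refl
  (from-yes (groupSizes? part 5)) (from-yes (Verifier.verify? part blocks-5-5))
  where part = standardPart 5 5 2

blocks-10-2 : List (Block 22)
blocks-10-2 =
    block (# 0) (# 10) (# 1) (# 17) (# 21) ∷ block (# 0) (# 10) (# 4) (# 15) (# 20) ∷
    block (# 0) (# 11) (# 3) (# 13) (# 20) ∷ block (# 0) (# 11) (# 4) (# 19) (# 20) ∷
    block (# 0) (# 12) (# 1) (# 11) (# 21) ∷ block (# 0) (# 12) (# 3) (# 15) (# 21) ∷
    block (# 0) (# 12) (# 6) (# 10) (# 20) ∷ block (# 0) (# 12) (# 8) (# 17) (# 20) ∷
    block (# 0) (# 13) (# 1) (# 19) (# 21) ∷ block (# 0) (# 13) (# 9) (# 17) (# 20) ∷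
    block (# 0) (# 14) (# 6) (# 13) (# 20) ∷ block (# 0) (# 14) (# 8) (# 10) (# 20) ∷
    block (# 0) (# 15) (# 2) (# 18) (# 20) ∷ block (# 0) (# 16) (# 1) (# 15) (# 21) ∷
    block (# 0) (# 16) (# 5) (# 10) (# 21) ∷ block (# 0) (# 17) (# 2) (# 11) (# 21) ∷
    block (# 0) (# 17) (# 3) (# 14) (# 21) ∷ block (# 0) (# 18) (# 3) (# 16) (# 20) ∷
    block (# 0) (# 18) (# 6) (# 19) (# 21) ∷ block (# 0) (# 18) (# 8) (# 11) (# 16) ∷
    block (# 0) (# 19) (# 3) (# 10) (# 21) ∷ block (# 1) (# 10) (# 4) (# 11) (# 21) ∷
    block (# 1) (# 11) (# 2) (# 18) (# 21) ∷ block (# 1) (# 11) (# 5) (# 16) (# 20) ∷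
    block (# 1) (# 12) (# 4) (# 14) (# 20) ∷ block (# 1) (# 12) (# 5) (# 10) (# 20) ∷
    block (# 1) (# 13) (# 2) (# 12) (# 21) ∷ block (# 1) (# 13) (# 4) (# 16) (# 21) ∷
    block (# 1) (# 13) (# 7) (# 11) (# 20) ∷ block (# 1) (# 13) (# 9) (# 18) (# 20) ∷
    block (# 1) (# 14) (# 0) (# 18) (# 20) ∷ block (# 1) (# 14) (# 2) (# 10) (# 21) ∷
    block (# 1) (# 15) (# 7) (# 14) (# 20) ∷ block (# 1) (# 15) (# 9) (# 11) (# 20) ∷
    block (# 1) (# 16) (# 3) (# 19) (# 20) ∷ block (# 1) (# 17) (# 2) (# 16) (# 21) ∷
    block (# 1) (# 17) (# 6) (# 11) (# 21) ∷ block (# 1) (# 18) (# 3) (# 12) (# 21) ∷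
    block (# 1) (# 18) (# 4) (# 15) (# 21) ∷ block (# 1) (# 19) (# 4) (# 17) (# 20) ∷
    block (# 1) (# 19) (# 7) (# 10) (# 21) ∷ block (# 1) (# 19) (# 9) (# 12) (# 17) ∷
    block (# 2) (# 10) (# 0) (# 13) (# 18) ∷ block (# 2) (# 10) (# 5) (# 18) (# 20) ∷
    block (# 2) (# 10) (# 8) (# 11) (# 21) ∷ block (# 2) (# 11) (# 5) (# 12) (# 21) ∷
    block (# 2) (# 12) (# 3) (# 19) (# 21) ∷ block (# 2) (# 12) (# 6) (# 17) (# 20) ∷
    block (# 2) (# 13) (# 5) (# 15) (# 20) ∷ block (# 2) (# 13) (# 6) (# 11) (# 20) ∷
    block (# 2) (# 14) (# 0) (# 19) (# 20) ∷ block (# 2) (# 14) (# 3) (# 13) (# 21) ∷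
    block (# 2) (# 14) (# 5) (# 17) (# 21) ∷ block (# 2) (# 14) (# 8) (# 12) (# 20) ∷
    block (# 2) (# 15) (# 1) (# 19) (# 20) ∷ block (# 2) (# 15) (# 3) (# 11) (# 21) ∷
    block (# 2) (# 16) (# 0) (# 12) (# 20) ∷ block (# 2) (# 16) (# 8) (# 15) (# 20) ∷
    block (# 2) (# 17) (# 4) (# 10) (# 20) ∷ block (# 2) (# 18) (# 3) (# 17) (# 21) ∷
    block (# 2) (# 18) (# 7) (# 12) (# 21) ∷ block (# 2) (# 19) (# 4) (# 13) (# 21) ∷
    block (# 2) (# 19) (# 5) (# 16) (# 21) ∷ block (# 3) (# 10) (# 5) (# 14) (# 21) ∷
    block (# 3) (# 10) (# 6) (# 17) (# 21) ∷ block (# 3) (# 11) (# 1) (# 14) (# 19) ∷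
    block (# 3) (# 11) (# 6) (# 19) (# 20) ∷ block (# 3) (# 11) (# 9) (# 12) (# 21) ∷
    block (# 3) (# 12) (# 6) (# 13) (# 21) ∷ block (# 3) (# 13) (# 4) (# 10) (# 21) ∷
    block (# 3) (# 13) (# 7) (# 18) (# 20) ∷ block (# 3) (# 14) (# 6) (# 16) (# 20) ∷
    block (# 3) (# 14) (# 7) (# 12) (# 20) ∷ block (# 3) (# 15) (# 1) (# 10) (# 20) ∷
    block (# 3) (# 15) (# 4) (# 14) (# 21) ∷ block (# 3) (# 15) (# 6) (# 18) (# 21) ∷
    block (# 3) (# 15) (# 9) (# 13) (# 20) ∷ block (# 3) (# 16) (# 2) (# 10) (# 20) ∷
    block (# 3) (# 16) (# 4) (# 12) (# 21) ∷ block (# 3) (# 17) (# 1) (# 13) (# 20) ∷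
    block (# 3) (# 17) (# 9) (# 16) (# 20) ∷ block (# 3) (# 18) (# 5) (# 11) (# 20) ∷
    block (# 3) (# 19) (# 4) (# 18) (# 21) ∷ block (# 3) (# 19) (# 8) (# 13) (# 21) ∷
    block (# 4) (# 10) (# 5) (# 19) (# 21) ∷ block (# 4) (# 10) (# 9) (# 14) (# 21) ∷
    block (# 4) (# 11) (# 6) (# 15) (# 21) ∷ block (# 4) (# 11) (# 7) (# 18) (# 21) ∷
    block (# 4) (# 12) (# 0) (# 13) (# 21) ∷ block (# 4) (# 12) (# 2) (# 15) (# 10) ∷
    block (# 4) (# 12) (# 7) (# 10) (# 20) ∷ block (# 4) (# 13) (# 7) (# 14) (# 21) ∷
    block (# 4) (# 14) (# 5) (# 11) (# 21) ∷ block (# 4) (# 14) (# 8) (# 19) (# 20) ∷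
    block (# 4) (# 15) (# 7) (# 17) (# 20) ∷ block (# 4) (# 15) (# 8) (# 13) (# 20) ∷
    block (# 4) (# 16) (# 0) (# 14) (# 20) ∷ block (# 4) (# 16) (# 2) (# 11) (# 20) ∷
    block (# 4) (# 16) (# 5) (# 15) (# 21) ∷ block (# 4) (# 16) (# 7) (# 19) (# 21) ∷
    block (# 4) (# 17) (# 3) (# 11) (# 20) ∷ block (# 4) (# 17) (# 5) (# 13) (# 21) ∷
    block (# 4) (# 18) (# 0) (# 17) (# 20) ∷ block (# 4) (# 18) (# 2) (# 14) (# 20) ∷
    block (# 4) (# 19) (# 6) (# 12) (# 20) ∷ block (# 5) (# 10) (# 7) (# 13) (# 20) ∷
    block (# 5) (# 11) (# 0) (# 15) (# 21) ∷ block (# 5) (# 11) (# 6) (# 10) (# 21) ∷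
    block (# 5) (# 12) (# 7) (# 16) (# 21) ∷ block (# 5) (# 12) (# 8) (# 19) (# 21) ∷
    block (# 5) (# 13) (# 1) (# 14) (# 21) ∷ block (# 5) (# 13) (# 3) (# 16) (# 11) ∷
    block (# 5) (# 13) (# 8) (# 11) (# 20) ∷ block (# 5) (# 14) (# 8) (# 15) (# 21) ∷
    block (# 5) (# 15) (# 6) (# 12) (# 21) ∷ block (# 5) (# 15) (# 9) (# 10) (# 20) ∷
    block (# 5) (# 16) (# 8) (# 18) (# 20) ∷ block (# 5) (# 16) (# 9) (# 14) (# 20) ∷
    block (# 5) (# 17) (# 1) (# 15) (# 20) ∷ block (# 5) (# 17) (# 3) (# 12) (# 20) ∷
    block (# 5) (# 17) (# 6) (# 16) (# 21) ∷ block (# 5) (# 17) (# 8) (# 10) (# 21) ∷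
    block (# 5) (# 18) (# 4) (# 12) (# 20) ∷ block (# 5) (# 18) (# 6) (# 14) (# 21) ∷
    block (# 5) (# 19) (# 1) (# 18) (# 20) ∷ block (# 5) (# 19) (# 3) (# 15) (# 20) ∷
    block (# 6) (# 10) (# 2) (# 19) (# 20) ∷ block (# 6) (# 10) (# 4) (# 16) (# 20) ∷
    block (# 6) (# 11) (# 8) (# 14) (# 20) ∷ block (# 6) (# 12) (# 1) (# 16) (# 21) ∷
    block (# 6) (# 12) (# 7) (# 11) (# 21) ∷ block (# 6) (# 13) (# 8) (# 17) (# 21) ∷
    block (# 6) (# 13) (# 9) (# 10) (# 21) ∷ block (# 6) (# 14) (# 2) (# 15) (# 21) ∷
    block (# 6) (# 14) (# 4) (# 17) (# 12) ∷ block (# 6) (# 14) (# 9) (# 12) (# 20) ∷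
    block (# 6) (# 15) (# 9) (# 16) (# 21) ∷ block (# 6) (# 16) (# 0) (# 11) (# 20) ∷
    block (# 6) (# 16) (# 7) (# 13) (# 21) ∷ block (# 6) (# 17) (# 0) (# 15) (# 20) ∷
    block (# 6) (# 17) (# 9) (# 19) (# 20) ∷ block (# 6) (# 18) (# 2) (# 16) (# 20) ∷
    block (# 6) (# 18) (# 4) (# 13) (# 20) ∷ block (# 6) (# 18) (# 7) (# 17) (# 21) ∷
    block (# 6) (# 18) (# 9) (# 11) (# 21) ∷ block (# 6) (# 19) (# 5) (# 13) (# 20) ∷
    block (# 6) (# 19) (# 7) (# 15) (# 21) ∷ block (# 7) (# 10) (# 6) (# 14) (# 20) ∷
    block (# 7) (# 10) (# 8) (# 16) (# 21) ∷ block (# 7) (# 11) (# 3) (# 10) (# 20) ∷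
    block (# 7) (# 11) (# 5) (# 17) (# 20) ∷ block (# 7) (# 12) (# 9) (# 15) (# 20) ∷
    block (# 7) (# 13) (# 2) (# 17) (# 21) ∷ block (# 7) (# 13) (# 8) (# 12) (# 21) ∷
    block (# 7) (# 14) (# 0) (# 11) (# 21) ∷ block (# 7) (# 14) (# 9) (# 18) (# 21) ∷
    block (# 7) (# 15) (# 0) (# 13) (# 20) ∷ block (# 7) (# 15) (# 3) (# 16) (# 21) ∷
    block (# 7) (# 15) (# 5) (# 18) (# 13) ∷ block (# 7) (# 16) (# 0) (# 17) (# 21) ∷
    block (# 7) (# 17) (# 1) (# 12) (# 20) ∷ block (# 7) (# 17) (# 8) (# 14) (# 21) ∷
    block (# 7) (# 18) (# 0) (# 10) (# 20) ∷ block (# 7) (# 18) (# 1) (# 16) (# 20) ∷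
    block (# 7) (# 19) (# 0) (# 12) (# 21) ∷ block (# 7) (# 19) (# 3) (# 17) (# 20) ∷
    block (# 7) (# 19) (# 5) (# 14) (# 20) ∷ block (# 7) (# 19) (# 8) (# 18) (# 21) ∷
    block (# 8) (# 10) (# 1) (# 13) (# 21) ∷ block (# 8) (# 10) (# 4) (# 18) (# 20) ∷
    block (# 8) (# 10) (# 6) (# 15) (# 20) ∷ block (# 8) (# 10) (# 9) (# 19) (# 21) ∷
    block (# 8) (# 11) (# 7) (# 15) (# 20) ∷ block (# 8) (# 11) (# 9) (# 17) (# 21) ∷
    block (# 8) (# 12) (# 4) (# 11) (# 20) ∷ block (# 8) (# 12) (# 6) (# 18) (# 20) ∷
    block (# 8) (# 13) (# 0) (# 16) (# 20) ∷ block (# 8) (# 14) (# 3) (# 18) (# 21) ∷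
    block (# 8) (# 14) (# 9) (# 13) (# 21) ∷ block (# 8) (# 15) (# 0) (# 19) (# 21) ∷
    block (# 8) (# 15) (# 1) (# 12) (# 21) ∷ block (# 8) (# 16) (# 1) (# 14) (# 20) ∷
    block (# 8) (# 16) (# 4) (# 17) (# 21) ∷ block (# 8) (# 16) (# 6) (# 19) (# 14) ∷
    block (# 8) (# 17) (# 1) (# 18) (# 21) ∷ block (# 8) (# 18) (# 2) (# 13) (# 20) ∷
    block (# 8) (# 18) (# 9) (# 15) (# 21) ∷ block (# 8) (# 19) (# 1) (# 11) (# 20) ∷
    block (# 8) (# 19) (# 2) (# 17) (# 20) ∷ block (# 9) (# 10) (# 2) (# 12) (# 20) ∷
    block (# 9) (# 10) (# 3) (# 18) (# 20) ∷ block (# 9) (# 11) (# 0) (# 10) (# 21) ∷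
    block (# 9) (# 11) (# 2) (# 14) (# 21) ∷ block (# 9) (# 11) (# 5) (# 19) (# 20) ∷
    block (# 9) (# 11) (# 7) (# 16) (# 20) ∷ block (# 9) (# 12) (# 0) (# 18) (# 21) ∷
    block (# 9) (# 12) (# 8) (# 16) (# 20) ∷ block (# 9) (# 13) (# 5) (# 12) (# 20) ∷
    block (# 9) (# 13) (# 7) (# 19) (# 20) ∷ block (# 9) (# 14) (# 1) (# 17) (# 20) ∷
    block (# 9) (# 15) (# 0) (# 14) (# 21) ∷ block (# 9) (# 15) (# 4) (# 19) (# 21) ∷
    block (# 9) (# 16) (# 1) (# 10) (# 21) ∷ block (# 9) (# 16) (# 2) (# 13) (# 21) ∷
    block (# 9) (# 17) (# 2) (# 15) (# 20) ∷ block (# 9) (# 17) (# 5) (# 18) (# 21) ∷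
    block (# 9) (# 17) (# 7) (# 10) (# 15) ∷ block (# 9) (# 18) (# 2) (# 19) (# 21) ∷
    block (# 9) (# 19) (# 0) (# 16) (# 21) ∷ block (# 9) (# 19) (# 3) (# 14) (# 20) ∷
    block (# 10) (# 12) (# 8) (# 3) (# 16) ∷ block (# 11) (# 13) (# 9) (# 4) (# 17) ∷
    block (# 12) (# 14) (# 0) (# 5) (# 18) ∷ block (# 13) (# 15) (# 1) (# 6) (# 19) ∷
    block (# 14) (# 16) (# 2) (# 7) (# 10) ∷ block (# 15) (# 17) (# 3) (# 8) (# 11) ∷
    block (# 16) (# 18) (# 4) (# 9) (# 12) ∷ block (# 17) (# 19) (# 5) (# 0) (# 13) ∷
    block (# 18) (# 10) (# 6) (# 1) (# 14) ∷ block (# 19) (# 11) (# 7) (# 2) (# 15) ∷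
    []

design-10-2 : CS 10 2 2
design-10-2 = certify part blocks-10-2 refl
  (from-yes (groupSizes? part 10)) (from-yes (Verifier.verify? part blocks-10-2))
  where part = standardPart 10 2 2

lemma3p6 : ∀ (g n : ℕ) →
    ((g , n) ≡ (5 , 3)) ⊎ ((g , n) ≡ (5 , 5)) ⊎ ((g , n) ≡ (10 , 2)) →
    CS g n 2
lemma3p6 .5  .3 (inj₁ refl)        = design-5-3
lemma3p6 .5  .5 (inj₂ (inj₁ refl)) = design-5-5
lemma3p6 .10 .2 (inj₂ (inj₂ refl)) = design-10-2
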